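{- $$\liminf_{a,b\to\infty} r(a,b)=1,$$ where $\liminf_{a,b\to\infty} r(a,b)$ means $\lim_{N\to\infty}\inf\{r(a,b): a,b\ge N\}$.
   Context: $\phi$ denotes Euler's totient function. For positive integers $a,b$, $c(a,b)$ is defined as the least positive integer $c$ such that $\phi(a!)\phi(b!)$ divides $\phi(c!)$, and $r(a,b)=c(a,b)/(a+b)$. -}

module Defs where

open import Data.Nat using (ℕ; zero; suc; _+_; _*_; _≤_; _<_)
open import Data.Nat using (_!)
open import Data.Nat.Divisibility using (_∣_)
open import Data.Nat.GCD using (gcd)
open import Data.List using (List; length; filter; upTo; map)
open import Data.Nat using (_≟_)
open import Data.Integer using (+_)
open import Data.Rational using (ℚ; _/_)
open import Data.Product using (_×_)

-- Euler's totient: φ n = #{ k : 1 ≤ k ≤ n , gcd k n = 1 }  (so φ 1 = 1, φ 0 = 0)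
φ : ℕ → ℕ
φ n = length (filter (λ k → gcd k n ≟ 1) (map suc (upTo n)))

IsC : ℕ → ℕ → ℕ → Set
IsC a b c = (0 < c) × (φ (a !) * φ (b !) ∣ φ (c !))
          × (∀ c′ → 0 < c′ → φ (a !) * φ (b !) ∣ φ (c′ !) → c ≤ c′)

-- the rational number c / m  (m = 0 gives 0; only used with m = a + b ≥ 2)
ratio : ℕ → ℕ → ℚ
ratio c zero = + 0 / 1
ratio c (suc m) = + c / suc m

r : ℕ → ℕ → ℕ → ℚ
r a b c = ratio c (a + b)

-- φ(n!) = ∏_{k ≤ n} (k − [k prime]), so the 2-adic valuation of φ(n!) lies between
-- ν₂(n!) − 1 and ν₂(n!) + Σ_{p ≤ n} ν₂(p − 1). Legendre's formula gives ν₂(n!) = n − o(n),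
-- and Σ_{p ≤ n} ν₂(p − 1) = o(n) because π(n) = o(n) (the primes in (m, 2m] divide the
-- central binomial coefficient) while few k ≤ n have large ν₂(k). Hence φ(a!) φ(b!) ∣ φ(c!)
-- forces c ≥ (1 − o(1)) (a + b). Conversely, if a + 1 is even and a multiple of φ(b!), then
-- φ((a + 1)!) = (a + 1) φ(a!) is divisible by φ(a!) φ(b!), so c(a, b) ≤ a + 1 ≤ a + b for
-- such pairs, which exist with a and b arbitrarily large.
module Submission where

open import Defs
open import Data.Nat.Base
  using (ℕ; zero; suc; _*_; _∸_; _^_; _≤_; _<_; z≤n; s≤s; _!; ⌊_/2⌋;
         NonZero; nonTrivial⇒nonZero; >-nonZero; >-nonZero⁻¹)
open import Data.Nat.Properties
open import Data.Nat.Divisibility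
open import Data.Nat.Coprimality as Coprime using (Coprime; coprime?)
open import Data.Nat.Primality using (Prime; prime?; prime⇒irreducible; ¬prime⇒composite; composite)
open import Data.Nat.Induction using (<-rec)
open import Data.Nat.Tactic.RingSolver using (solve-∀)
open import Data.Product using (Σ; ∃; ∃₂; _×_; _,_; proj₁; proj₂)
open import Data.Sum using (_⊎_; inj₁; inj₂; [_,_]′)
open import Data.Empty using (⊥-elim)
open import Relation.Nullary using (Dec; yes; no; ¬_; _×-dec_)
open import Relation.Unary using (Decidable)
open import Relation.Binary.PropositionalEquality
  using (_≡_; _≢_; refl; sym; trans; cong; cong₂; subst; subst₂; module ≡-Reasoning)

𝟙 : ∀ {p} {P : Set p} → Dec P → ℕ
𝟙 (yes _) = 1
𝟙 (no _)  = 0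

𝟙≤1 : ∀ {p} {P : Set p} (P? : Dec P) → 𝟙 P? ≤ 1
𝟙≤1 (yes _) = ≤-refl
𝟙≤1 (no _)  = z≤n

𝟙-cong : ∀ {p q} {P : Set p} {Q : Set q} → (P → Q) → (Q → P) →
         (P? : Dec P) (Q? : Dec Q) → 𝟙 P? ≡ 𝟙 Q?
𝟙-cong P→Q Q→P (yes _) (yes _) = refl
𝟙-cong P→Q Q→P (yes p) (no ¬q) = ⊥-elim (¬q (P→Q p))
𝟙-cong P→Q Q→P (no ¬p) (yes q) = ⊥-elim (¬p (Q→P q))
𝟙-cong P→Q Q→P (no _)  (no _)  = refl

coprime-∣ˡ : ∀ {i j n} → i ∣ j → Coprime j n → Coprime i n
coprime-∣ˡ i∣j c (d∣i , d∣n) = c (∣-trans d∣i i∣j , d∣n)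

coprime-∣ʳ : ∀ {i j n} → i ∣ n → Coprime j n → Coprime j i
coprime-∣ʳ i∣n c (d∣j , d∣i) = c (d∣j , ∣-trans d∣i i∣n)

coprime-*ʳ : ∀ {p a b} → Coprime p a → Coprime p b → Coprime p (a * b)
coprime-*ʳ ca cb (d∣p , d∣ab) = cb (d∣p , Coprime.coprime-divisor (coprime-∣ˡ d∣p ca) d∣ab)

m∣k*k⇒coprime-* : ∀ {m k j} → m ∣ k * k → Coprime j k → Coprime j (m * k)
m∣k*k⇒coprime-* {m} {k} m∣k*k c {d} (d∣j , d∣m*k) = c (d∣j , d∣k)
  where
  d⊥k : Coprime d k
  d⊥k = coprime-∣ˡ d∣j c
  d∣k : d ∣ k
  d∣k = Coprime.coprime-divisor d⊥k
          (∣-trans (Coprime.coprime-divisor d⊥k (subst (d ∣_) (*-comm m k) d∣m*k)) m∣k*k)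

prime⇒coprime-! : ∀ {p} → Prime p → ∀ m → m < p → Coprime p (m !)
prime⇒coprime-! p-prime zero    _   = Coprime.sym (Coprime.1-coprimeTo _)
prime⇒coprime-! p-prime (suc m) m<p =
  coprime-*ʳ (Coprime.prime⇒coprime p-prime m<p) (prime⇒coprime-! p-prime m (<-trans (n<1+n m) m<p))

coprime⇒*-∣ : ∀ {a b x} → Coprime a b → a ∣ x → b ∣ x → a * b ∣ x
coprime⇒*-∣ {a} {b} a⊥b a∣x (divides y refl) =
  *-monoˡ-∣ b (Coprime.coprime-divisor a⊥b (subst (a ∣_) (*-comm y b) a∣x))

leastBelow⊎noneBelow : ∀ {ℓ} {P : ℕ → Set ℓ} → Decidable P → ∀ b →
                       (∃ λ c → c < b × P c × (∀ c′ → P c′ → c ≤ c′)) ⊎ (∀ c′ → c′ < b → ¬ P c′)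
leastBelow⊎noneBelow P? zero = inj₂ (λ _ ())
leastBelow⊎noneBelow P? (suc b) with leastBelow⊎noneBelow P? b
... | inj₁ (c , c<b , Pc , minimal) = inj₁ (c , m<n⇒m<1+n c<b , Pc , minimal)
... | inj₂ noneBelow with P? b
...   | yes Pb = inj₁ (b , ≤-refl , Pb , λ c′ Pc′ → ≮⇒≥ (λ c′<b → noneBelow c′ c′<b Pc′))
...   | no ¬Pb = inj₂ λ c′ c′<1+b →
  [ noneBelow c′ , (λ { refl → ¬Pb }) ]′ (m<1+n⇒m<n∨m≡n c′<1+b)

leastWitness : ∀ {ℓ} {P : ℕ → Set ℓ} → Decidable P → ∀ {w} → P w →
               ∃ λ c → c ≤ w × P c × (∀ c′ → P c′ → c ≤ c′)
leastWitness P? {w} Pw with leastBelow⊎noneBelow P? (suc w)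
... | inj₁ (c , c<1+w , Pc , minimal) = c , ≤-pred c<1+w , Pc , minimal
... | inj₂ noneBelow = ⊥-elim (noneBelow w ≤-refl Pw)

-- ℕ addition is opened module by module: the theorem at the end uses ℚ's _+_.
module Parity where
  open import Data.Nat.Base using (_+_)

  Odd : ℕ → Set
  Odd n = ∃ λ q → n ≡ suc (2 * q)

  2*1+n≡2+2*n : ∀ n → 2 * suc n ≡ suc (suc (2 * n))
  2*1+n≡2+2*n = solve-∀

  even⊎odd : ∀ n → n ≡ 2 * ⌊ n /2⌋ ⊎ n ≡ suc (2 * ⌊ n /2⌋)
  even⊎odd zero          = inj₁ refl
  even⊎odd (suc zero)    = inj₂ refl
  even⊎odd (suc (suc n)) with even⊎odd n
  ... | inj₁ even = inj₁ (trans (cong (λ m → suc (suc m)) even) (sym (2*1+n≡2+2*n ⌊ n /2⌋)))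
  ... | inj₂ odd  = inj₂ (trans (cong (λ m → suc (suc m)) odd) (cong suc (sym (2*1+n≡2+2*n ⌊ n /2⌋))))

  2*⌊n/2⌋≤n : ∀ n → 2 * ⌊ n /2⌋ ≤ n
  2*⌊n/2⌋≤n n with even⊎odd n
  ... | inj₁ even = ≤-reflexive (sym even)
  ... | inj₂ odd  = ≤-trans (n≤1+n _) (≤-reflexive (sym odd))

  n≤1+2*⌊n/2⌋ : ∀ n → n ≤ suc (2 * ⌊ n /2⌋)
  n≤1+2*⌊n/2⌋ n with even⊎odd n
  ... | inj₁ even = ≤-trans (≤-reflexive even) (n≤1+n _)
  ... | inj₂ odd  = ≤-reflexive odd

  ⌊2*n/2⌋≡n : ∀ n → ⌊ 2 * n /2⌋ ≡ n
  ⌊2*n/2⌋≡n n = trans (cong ⌊_/2⌋ (cong (n +_) (+-identityʳ n))) (sym (n≡⌊n+n/2⌋ n))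

  2*m≤n⇒m≤⌊n/2⌋ : ∀ {m n} → 2 * m ≤ n → m ≤ ⌊ n /2⌋
  2*m≤n⇒m≤⌊n/2⌋ {m} 2m≤n = ≤-trans (≤-reflexive (sym (⌊2*n/2⌋≡n m))) (⌊n/2⌋-mono 2m≤n)

  odd-* : ∀ {m n} → Odd m → Odd n → Odd (m * n)
  odd-* (q , refl) (r , refl) = q + r + 2 * q * r , expand q r
    where
    expand : ∀ q r → suc (2 * q) * suc (2 * r) ≡ suc (2 * (q + r + 2 * q * r))
    expand = solve-∀

  odd⇒2∤ : ∀ {n} → Odd n → ¬ (2 ∣ n)
  odd⇒2∤ (q , refl) (divides k eq) = even≢odd k q (trans (*-comm 2 k) (sym eq))

  2∤⇒odd : ∀ {n} → ¬ (2 ∣ n) → Odd n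
  2∤⇒odd {n} 2∤n with even⊎odd n
  ... | inj₁ even = ⊥-elim (2∤n (divides ⌊ n /2⌋ (trans even (*-comm 2 ⌊ n /2⌋))))
  ... | inj₂ odd  = ⌊ n /2⌋ , odd

open Parity

module FiniteSums where
  open import Data.Nat.Base using (_+_)

  -- ∑ f n = f 1 + ⋯ + f n: the range starts at 1, as in φ.
  ∑ : (ℕ → ℕ) → ℕ → ℕ
  ∑ f zero    = 0
  ∑ f (suc n) = ∑ f n + f (suc n)

  ∑-cong : ∀ {f g} n → (∀ k → k < n → f (suc k) ≡ g (suc k)) → ∑ f n ≡ ∑ g n
  ∑-cong zero    f≗g = refl
  ∑-cong (suc n) f≗g = cong₂ _+_ (∑-cong n (λ k k<n → f≗g k (m<n⇒m<1+n k<n))) (f≗g n ≤-refl)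

  ∑-mono-≤ : ∀ {f g} n → (∀ k → k < n → f (suc k) ≤ g (suc k)) → ∑ f n ≤ ∑ g n
  ∑-mono-≤ zero    f≤g = z≤n
  ∑-mono-≤ (suc n) f≤g = +-mono-≤ (∑-mono-≤ n (λ k k<n → f≤g k (m<n⇒m<1+n k<n))) (f≤g n ≤-refl)

  ∑-monoʳ-≤ : ∀ f {m n} → m ≤ n → ∑ f m ≤ ∑ f n
  ∑-monoʳ-≤ f {n = zero}  z≤n = ≤-refl
  ∑-monoʳ-≤ f {m} {suc n} m≤1+n with m≤n⇒m<n∨m≡n m≤1+n
  ... | inj₁ m<1+n = ≤-trans (∑-monoʳ-≤ f (≤-pred m<1+n)) (m≤m+n (∑ f n) _)
  ... | inj₂ refl  = ≤-refl

  ∑-const : ∀ c n → ∑ (λ _ → c) n ≡ n * c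
  ∑-const c zero    = refl
  ∑-const c (suc n) = trans (cong (_+ c) (∑-const c n)) (+-comm (n * c) c)

  ∑-distrib-+ : ∀ f g n → ∑ (λ k → f k + g k) n ≡ ∑ f n + ∑ g n
  ∑-distrib-+ f g zero    = refl
  ∑-distrib-+ f g (suc n) rewrite ∑-distrib-+ f g n =
    +-+-comm-middle (∑ f n) (∑ g n) (f (suc n)) (g (suc n))
    where
    +-+-comm-middle : ∀ a b c d → a + b + (c + d) ≡ a + c + (b + d)
    +-+-comm-middle = solve-∀

  ∑-distribˡ-* : ∀ m f n → ∑ (λ k → m * f k) n ≡ m * ∑ f n
  ∑-distribˡ-* m f zero    = sym (*-zeroʳ m)
  ∑-distribˡ-* m f (suc n) rewrite ∑-distribˡ-* m f n = sym (*-distribˡ-+ m (∑ f n) (f (suc n)))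

  ∑-+ : ∀ f m n → ∑ f (m + n) ≡ ∑ f m + ∑ (λ k → f (m + k)) n
  ∑-+ f m zero    rewrite +-identityʳ m = sym (+-identityʳ (∑ f m))
  ∑-+ f m (suc n) rewrite +-suc m n | ∑-+ f m n = +-assoc (∑ f m) _ _

  ∑-pred : ∀ f n → ∑ (λ k → f (k ∸ 1)) (suc n) ≡ f 0 + ∑ f n
  ∑-pred f zero    = sym (+-identityʳ (f 0))
  ∑-pred f (suc n) = trans (cong (_+ f (suc n)) (∑-pred f n)) (+-assoc (f 0) _ _)

  ∑-periodic : ∀ f m → (∀ k → f (m + k) ≡ f k) → ∀ q → ∑ f (q * m) ≡ q * ∑ f m
  ∑-periodic f m periodic zero    = refl
  ∑-periodic f m periodic (suc q) = begin
    ∑ f (m + q * m)                         ≡⟨ ∑-+ f m (q * m) ⟩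
    ∑ f m + ∑ (λ k → f (m + k)) (q * m)     ≡⟨ cong (∑ f m +_) (∑-cong (q * m) (λ k _ → periodic (suc k))) ⟩
    ∑ f m + ∑ f (q * m)                     ≡⟨ cong (∑ f m +_) (∑-periodic f m periodic q) ⟩
    ∑ f m + q * ∑ f m                       ∎
    where open ≡-Reasoning

  ∑-multiples : ∀ f p → (∀ j → ¬ (suc p ∣ j) → f j ≡ 0) →
                ∀ q → ∑ f (q * suc p) ≡ ∑ (λ i → f (i * suc p)) q
  ∑-multiples f p vanishes zero    = refl
  ∑-multiples f p vanishes (suc q) = begin
    ∑ f (suc p + m)                                   ≡⟨ cong (∑ f) (+-comm (suc p) m) ⟩
    ∑ f (m + suc p)                                   ≡⟨ ∑-+ f m (suc p) ⟩
    ∑ f m + (∑ (λ j → f (m + j)) p + f (m + suc p))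
      ≡⟨ cong₂ (λ x y → x + (y + f (m + suc p))) (∑-multiples f p vanishes q) gap≡0 ⟩
    ∑ (λ i → f (i * suc p)) q + f (m + suc p)         ≡⟨ cong (λ x → ∑ (λ i → f (i * suc p)) q + f x) (+-comm m (suc p)) ⟩
    ∑ (λ i → f (i * suc p)) (suc q)                   ∎
    where
    open ≡-Reasoning
    m = q * suc p
    gap≡0 : ∑ (λ j → f (m + j)) p ≡ 0
    gap≡0 = trans (∑-cong p (λ j j<p → vanishes _ (λ p∣ → <⇒≱ (s≤s j<p) (∣⇒≤ (∣m+n∣m⇒∣n p∣ (n∣m*n q))))))
                  (trans (∑-const 0 p) (*-zeroʳ p))

  ∑-even-range : ∀ f → (∀ q → f (suc (2 * q)) ≡ 0) → ∀ h → ∑ f (2 * h) ≡ ∑ (λ i → f (i * 2)) h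
  ∑-even-range f odd≡0 h = trans (cong (∑ f) (*-comm 2 h)) (∑-multiples f 1 vanishes h)
    where
    vanishes : ∀ j → ¬ (2 ∣ j) → f j ≡ 0
    vanishes j 2∤j with 2∤⇒odd 2∤j
    ... | q , refl = odd≡0 q

  ∑-evens : ∀ f → (∀ q → f (suc (2 * q)) ≡ 0) → ∀ n → ∑ f n ≡ ∑ (λ i → f (i * 2)) ⌊ n /2⌋
  ∑-evens f odd≡0 n with even⊎odd n
  ... | inj₁ even = trans (cong (∑ f) even) (∑-even-range f odd≡0 ⌊ n /2⌋)
  ... | inj₂ odd  = begin
    ∑ f n                                     ≡⟨ cong (∑ f) odd ⟩
    ∑ f (2 * ⌊ n /2⌋) + f (suc (2 * ⌊ n /2⌋)) ≡⟨ cong (∑ f (2 * ⌊ n /2⌋) +_) (odd≡0 ⌊ n /2⌋) ⟩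
    ∑ f (2 * ⌊ n /2⌋) + 0                     ≡⟨ +-identityʳ _ ⟩
    ∑ f (2 * ⌊ n /2⌋)                         ≡⟨ ∑-even-range f odd≡0 ⌊ n /2⌋ ⟩
    ∑ (λ i → f (i * 2)) ⌊ n /2⌋               ∎
    where open ≡-Reasoning

open FiniteSums

module TotientOfFactorial where
  open import Data.Nat.Base using (_+_)
  open import Data.Nat.GCD using (gcd)
  open import Data.List using ([]; _∷_; length; filter; map; upTo; _++_)
  import Data.List.Properties as List
  open import Function.Base using (id)
  open import Relation.Unary using (Pred)

  length-filter-upTo : ∀ {ℓ} {P : Pred ℕ ℓ} (P? : Decidable P) n →
                       length (filter P? (map suc (upTo n))) ≡ ∑ (λ k → 𝟙 (P? k)) n
  length-filter-upTo P? zero    = refl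
  length-filter-upTo P? (suc n) = begin
    length (filter P? (map suc (upTo (suc n))))
      ≡⟨ cong (λ l → length (filter P? (map suc l))) (sym (List.applyUpTo-∷ʳ id n)) ⟩
    length (filter P? (map suc (upTo n ++ n ∷ [])))
      ≡⟨ cong (λ l → length (filter P? l)) (List.map-++ suc (upTo n) (n ∷ [])) ⟩
    length (filter P? (map suc (upTo n) ++ suc n ∷ []))
      ≡⟨ cong length (List.filter-++ P? (map suc (upTo n)) (suc n ∷ [])) ⟩
    length (filter P? (map suc (upTo n)) ++ filter P? (suc n ∷ []))
      ≡⟨ List.length-++ (filter P? (map suc (upTo n))) ⟩
    length (filter P? (map suc (upTo n))) + length (filter P? (suc n ∷ []))
      ≡⟨ cong₂ _+_ (length-filter-upTo P? n) (length-filter-[x] (suc n)) ⟩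
    ∑ (λ k → 𝟙 (P? k)) n + 𝟙 (P? (suc n))
      ∎
    where
    open ≡-Reasoning
    length-filter-[x] : ∀ x → length (filter P? (x ∷ [])) ≡ 𝟙 (P? x)
    length-filter-[x] x with P? x
    ... | yes _ = refl
    ... | no _  = refl

  φ≡∑coprime : ∀ n → φ n ≡ ∑ (λ k → 𝟙 (coprime? k n)) n
  φ≡∑coprime n = trans (length-filter-upTo (λ k → gcd k n ≟ 1) n)
    (∑-cong n (λ k _ → 𝟙-cong Coprime.gcd≡1⇒coprime Coprime.coprime⇒gcd≡1 _ _))

  coprime-periodic : ∀ n j → 𝟙 (coprime? (n + j) n) ≡ 𝟙 (coprime? j n)
  coprime-periodic n j = 𝟙-cong (λ c {d} (d∣j , d∣n) → c (∣m∣n⇒∣m+n d∣n d∣j , d∣n))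
                                Coprime.coprime-+ _ _

  ∑coprime-periodic : ∀ k q → ∑ (λ j → 𝟙 (coprime? j k)) (q * k) ≡ q * φ k
  ∑coprime-periodic k q = trans (∑-periodic _ k (coprime-periodic k) q) (cong (q *_) (sym (φ≡∑coprime k)))

  m∣k*k⇒φ[m*k]≡m*φ[k] : ∀ m k → m ∣ k * k → φ (m * k) ≡ m * φ k
  m∣k*k⇒φ[m*k]≡m*φ[k] m k m∣k*k = begin
    φ (m * k)                                  ≡⟨ φ≡∑coprime (m * k) ⟩
    ∑ (λ j → 𝟙 (coprime? j (m * k))) (m * k)  ≡⟨ ∑-cong (m * k) (λ j _ → coprime-mk⇔coprime-k (suc j)) ⟩
    ∑ (λ j → 𝟙 (coprime? j k)) (m * k)        ≡⟨ ∑coprime-periodic k m ⟩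
    m * φ k                                    ∎
    where
    open ≡-Reasoning
    coprime-mk⇔coprime-k : ∀ j → 𝟙 (coprime? j (m * k)) ≡ 𝟙 (coprime? j k)
    coprime-mk⇔coprime-k j = 𝟙-cong (coprime-∣ʳ (n∣m*n m)) (m∣k*k⇒coprime-* m∣k*k) _ _

  prime≢1 : ∀ {p} → Prime p → p ≢ 1
  prime≢1 {suc (suc _)} _ ()

  -- The j ≤ p k coprime to k are those coprime to p k together with the multiples i p
  -- for i ≤ k coprime to k; by periodicity the former side sums to p φ(k).
  prime⇒φ[p*k]+φ[k]≡p*φ[k] : ∀ {p k} → Prime p → Coprime p k → φ (p * k) + φ k ≡ p * φ k
  prime⇒φ[p*k]+φ[k]≡p*φ[k] {suc p′} {k} p-prime p⊥k = begin
    φ (p * k) + φ k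
      ≡⟨ cong₂ _+_ (φ≡∑coprime (p * k)) (trans (φ≡∑coprime k) (∑-cong k (λ i _ → sym (multiple (suc i))))) ⟩
    ∑ (coprimeTo (p * k)) (p * k) + ∑ (λ i → multipleCoprime (i * p)) k
      ≡⟨ cong (∑ (coprimeTo (p * k)) (p * k) +_) (sym (∑-multiples multipleCoprime p′ offMultiple k)) ⟩
    ∑ (coprimeTo (p * k)) (p * k) + ∑ multipleCoprime (k * p)
      ≡⟨ cong (λ x → ∑ (coprimeTo (p * k)) (p * k) + ∑ multipleCoprime x) (*-comm k p) ⟩
    ∑ (coprimeTo (p * k)) (p * k) + ∑ multipleCoprime (p * k)
      ≡⟨ sym (∑-distrib-+ (coprimeTo (p * k)) multipleCoprime (p * k)) ⟩
    ∑ (λ j → coprimeTo (p * k) j + multipleCoprime j) (p * k)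
      ≡⟨ ∑-cong (p * k) (λ j _ → sym (split (suc j))) ⟩
    ∑ (coprimeTo k) (p * k)
      ≡⟨ ∑coprime-periodic k p ⟩
    p * φ k
      ∎
    where
    open ≡-Reasoning
    p = suc p′

    coprimeTo : ℕ → ℕ → ℕ
    coprimeTo n j = 𝟙 (coprime? j n)

    multipleCoprime : ℕ → ℕ
    multipleCoprime j = 𝟙 (coprime? j k ×-dec p ∣? j)

    split : ∀ j → coprimeTo k j ≡ coprimeTo (p * k) j + multipleCoprime j
    split j with coprime? j k | p ∣? j | coprime? j (p * k)
    ... | yes _   | yes p∣j | yes j⊥pk = ⊥-elim (prime≢1 p-prime (j⊥pk (p∣j , m∣m*n k)))
    ... | yes _   | yes _   | no _     = refl
    ... | yes j⊥k | no p∤j  | no ¬j⊥pk = ⊥-elim (¬j⊥pk j⊥pk)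
      where
      j⊥pk : Coprime j (p * k)
      j⊥pk {d} (d∣j , d∣pk)
        with prime⇒irreducible p-prime
               (Coprime.coprime-divisor (coprime-∣ˡ d∣j j⊥k) (subst (d ∣_) (*-comm p k) d∣pk))
      ... | inj₁ d≡1 = d≡1
      ... | inj₂ refl = ⊥-elim (p∤j d∣j)
    ... | yes _   | no _    | yes _    = refl
    ... | no ¬j⊥k | _       | yes j⊥pk = ⊥-elim (¬j⊥k (coprime-∣ʳ (n∣m*n p) j⊥pk))
    ... | no _    | yes _   | no _     = refl
    ... | no _    | no _    | no _     = refl

    offMultiple : ∀ j → ¬ (p ∣ j) → multipleCoprime j ≡ 0
    offMultiple j p∤j with coprime? j k | p ∣? j
    ... | _     | yes p∣j = ⊥-elim (p∤j p∣j)
    ... | yes _ | no _    = refl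
    ... | no _  | no _    = refl

    multiple : ∀ i → multipleCoprime (i * p) ≡ coprimeTo k i
    multiple i = 𝟙-cong forward backward _ _
      where
      forward : Coprime (i * p) k × p ∣ i * p → Coprime i k
      forward (ip⊥k , _) = coprime-∣ˡ (m∣m*n p) ip⊥k
      backward : Coprime i k → Coprime (i * p) k × p ∣ i * p
      backward i⊥k = (λ {d} (d∣ip , d∣k) → i⊥k (Coprime.coprime-divisor (coprime-∣ˡ d∣k (Coprime.sym p⊥k))
                                                  (subst (d ∣_) (*-comm i p) d∣ip) , d∣k))
                   , n∣m*n i

  ¬prime⇒[1+n]∣n!*n! : ∀ n → ¬ Prime (suc n) → suc n ∣ n ! * n !
  ¬prime⇒[1+n]∣n!*n! zero    _       = 1∣ _
  ¬prime⇒[1+n]∣n!*n! (suc n) ¬prime with ¬prime⇒composite ¬prime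
  ... | composite {d} d<2+n d∣2+n =
    subst (_∣ suc n ! * suc n !) (sym (_∣_.equality d∣2+n))
          (*-pres-∣ (∣-! (quotient d∣2+n) {{quotient≢0 d∣2+n}} (≤-pred (quotient-< d∣2+n)))
                    (∣-! d {{nonTrivial⇒nonZero d}} (≤-pred d<2+n)))
    where
    ∣-! : ∀ x .{{_ : NonZero x}} → x ≤ suc n → x ∣ suc n !
    ∣-! (suc y) y<1+n = ∣-trans (m∣m*n (y !)) (m≤n⇒m!∣n! y<1+n)

  φ! : ℕ → ℕ
  φ! zero    = 1
  φ! (suc n) = (suc n ∸ 𝟙 (prime? (suc n))) * φ! n

  φ[n!]≡φ! : ∀ n → φ (n !) ≡ φ! n
  φ[n!]≡φ! zero    = refl
  φ[n!]≡φ! (suc n) with prime? (suc n)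
  ... | no ¬prime = trans (m∣k*k⇒φ[m*k]≡m*φ[k] (suc n) (n !) (¬prime⇒[1+n]∣n!*n! n ¬prime))
                          (cong (suc n *_) (φ[n!]≡φ! n))
  ... | yes [1+n]-prime = trans (+-cancelʳ-≡ (φ (n !)) _ _ recurrence) (cong (n *_) (φ[n!]≡φ! n))
    where
    recurrence : φ (suc n !) + φ (n !) ≡ n * φ (n !) + φ (n !)
    recurrence =
      trans (prime⇒φ[p*k]+φ[k]≡p*φ[k] [1+n]-prime (prime⇒coprime-! [1+n]-prime n (n<1+n n))) (+-comm (φ (n !)) _)

open TotientOfFactorial

module TwoAdicValuation where
  open import Data.Nat.Base using (_+_)

  2^e*odd : ∀ n → 1 ≤ n → ∃₂ λ e o → Odd o × n ≡ 2 ^ e * o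
  2^e*odd = <-rec _ decompose
    where
    decompose : ∀ n → (∀ {m} → m < n → 1 ≤ m → ∃₂ λ e o → Odd o × m ≡ 2 ^ e * o) →
                1 ≤ n → ∃₂ λ e o → Odd o × n ≡ 2 ^ e * o
    decompose (suc n) rec _ with even⊎odd (suc n)
    ... | inj₂ odd  = 0 , suc n , (⌊ suc n /2⌋ , odd) , sym (+-identityʳ (suc n))
    ... | inj₁ even with rec (⌊n/2⌋<n n) (half-pos even)
      where
      half-pos : ∀ {h} → suc n ≡ 2 * h → 1 ≤ h
      half-pos {suc _} _ = s≤s z≤n
    ... | e , o , o-odd , eq =
      suc e , o , o-odd , trans even (trans (cong (2 *_) eq) (sym (*-assoc 2 (2 ^ e) o)))

  -- ν₂ 0 = 0 is a junk value: every statement about ν₂ n assumes 1 ≤ n.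
  ν₂ : ℕ → ℕ
  ν₂ zero    = 0
  ν₂ (suc n) = proj₁ (2^e*odd (suc n) (s≤s z≤n))

  ν₂-spec : ∀ n → 1 ≤ n → ∃ λ o → Odd o × n ≡ 2 ^ ν₂ n * o
  ν₂-spec (suc n) _ = proj₂ (2^e*odd (suc n) (s≤s z≤n))

  2^e*odd-injective : ∀ e e′ {o o′} → Odd o → Odd o′ → 2 ^ e * o ≡ 2 ^ e′ * o′ → e ≡ e′
  2^e*odd-injective zero    zero     _     _      _  = refl
  2^e*odd-injective zero    (suc e′) {o} {o′} o-odd _ eq =
    ⊥-elim (odd⇒2∤ o-odd (divides (2 ^ e′ * o′) (trans (sym (+-identityʳ o))
                          (trans eq (trans (*-assoc 2 (2 ^ e′) o′) (*-comm 2 (2 ^ e′ * o′)))))))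
  2^e*odd-injective (suc e) zero     {o} {o′} _ o′-odd eq =
    ⊥-elim (odd⇒2∤ o′-odd (divides (2 ^ e * o) (trans (sym (+-identityʳ o′))
                           (trans (sym eq) (trans (*-assoc 2 (2 ^ e) o) (*-comm 2 (2 ^ e * o)))))))
  2^e*odd-injective (suc e) (suc e′) {o} {o′} o-odd o′-odd eq = cong suc (2^e*odd-injective e e′ o-odd o′-odd
    (*-cancelˡ-≡ _ _ 2 (trans (sym (*-assoc 2 (2 ^ e) o)) (trans eq (*-assoc 2 (2 ^ e′) o′)))))

  ν₂[2^e*odd]≡e : ∀ e {o} → Odd o → ν₂ (2 ^ e * o) ≡ e
  ν₂[2^e*odd]≡e e {o} o-odd@(q , refl) = 2^e*odd-injective _ e (proj₁ (proj₂ spec)) o-odd (sym (proj₂ (proj₂ spec)))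
    where
    spec = ν₂-spec (2 ^ e * o) (≤-trans (s≤s z≤n) (m≤n*m o (2 ^ e) {{m^n≢0 2 e}}))

  ν₂-* : ∀ {m n} → 1 ≤ m → 1 ≤ n → ν₂ (m * n) ≡ ν₂ m + ν₂ n
  ν₂-* {m} {n} 1≤m 1≤n with ν₂-spec m 1≤m | ν₂-spec n 1≤n
  ... | o , o-odd , m≡ | o′ , o′-odd , n≡ = begin
    ν₂ (m * n)                              ≡⟨ cong ν₂ (cong₂ _*_ m≡ n≡) ⟩
    ν₂ (2 ^ ν₂ m * o * (2 ^ ν₂ n * o′))     ≡⟨ cong ν₂ (regroup (2 ^ ν₂ m) (2 ^ ν₂ n) o o′) ⟩
    ν₂ (2 ^ ν₂ m * 2 ^ ν₂ n * (o * o′))     ≡⟨ cong (λ x → ν₂ (x * (o * o′))) (sym (^-distribˡ-+-* 2 (ν₂ m) (ν₂ n))) ⟩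
    ν₂ (2 ^ (ν₂ m + ν₂ n) * (o * o′))       ≡⟨ ν₂[2^e*odd]≡e (ν₂ m + ν₂ n) (odd-* o-odd o′-odd) ⟩
    ν₂ m + ν₂ n                             ∎
    where
    open ≡-Reasoning
    regroup : ∀ a b c d → a * c * (b * d) ≡ a * b * (c * d)
    regroup = solve-∀

  ν₂-odd : ∀ q → ν₂ (suc (2 * q)) ≡ 0
  ν₂-odd q = trans (cong ν₂ (sym (+-identityʳ (suc (2 * q))))) (ν₂[2^e*odd]≡e 0 (q , refl))

  ν₂-2* : ∀ {n} → 1 ≤ n → ν₂ (2 * n) ≡ suc (ν₂ n)
  ν₂-2* 1≤n = ν₂-* {2} (s≤s z≤n) 1≤n

  ν₂-mono-∣ : ∀ {m n} → 1 ≤ n → m ∣ n → ν₂ m ≤ ν₂ n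
  ν₂-mono-∣ {m} {n} 1≤n (divides q n≡q*m) =
    ≤-trans (m≤n+m (ν₂ m) (ν₂ q)) (≤-reflexive (trans (sym (ν₂-* 1≤q 1≤m)) (cong ν₂ (sym n≡q*m))))
    where
    1≤q*m : 1 ≤ q * m
    1≤q*m = subst (1 ≤_) n≡q*m 1≤n
    1≤q : 1 ≤ q
    1≤q = >-nonZero⁻¹ q {{m*n≢0⇒m≢0 q {{>-nonZero 1≤q*m}}}}
    1≤m : 1 ≤ m
    1≤m = >-nonZero⁻¹ m {{m*n≢0⇒n≢0 q {{>-nonZero 1≤q*m}}}}

open TwoAdicValuation

module Legendre where
  open import Data.Nat.Base using (_+_)

  n<2^n : ∀ n → n < 2 ^ n
  n<2^n zero    = s≤s z≤n
  n<2^n (suc n) = begin-strict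
    suc n            ≡⟨ +-comm 1 n ⟩
    n + 1            <⟨ +-mono-<-≤ (n<2^n n) (m^n>0 2 n) ⟩
    2 ^ n + 2 ^ n    ≡⟨ cong (2 ^ n +_) (sym (+-identityʳ (2 ^ n))) ⟩
    2 ^ suc n        ∎
    where open ≤-Reasoning

  ⌊_/2^_⌋ : ℕ → ℕ → ℕ
  ⌊ n /2^ zero  ⌋ = n
  ⌊ n /2^ suc s ⌋ = ⌊ ⌊ n /2⌋ /2^ s ⌋

  ⌊n/2^s⌋≤n : ∀ n s → ⌊ n /2^ s ⌋ ≤ n
  ⌊n/2^s⌋≤n n zero    = ≤-refl
  ⌊n/2^s⌋≤n n (suc s) = ≤-trans (⌊n/2^s⌋≤n ⌊ n /2⌋ s) (⌊n/2⌋≤n n)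

  2^s*⌊n/2^s⌋≤n : ∀ n s → 2 ^ s * ⌊ n /2^ s ⌋ ≤ n
  2^s*⌊n/2^s⌋≤n n zero    = ≤-reflexive (+-identityʳ n)
  2^s*⌊n/2^s⌋≤n n (suc s) = begin
    2 * 2 ^ s * ⌊ ⌊ n /2⌋ /2^ s ⌋   ≡⟨ *-assoc 2 (2 ^ s) _ ⟩
    2 * (2 ^ s * ⌊ ⌊ n /2⌋ /2^ s ⌋) ≤⟨ *-monoʳ-≤ 2 (2^s*⌊n/2^s⌋≤n ⌊ n /2⌋ s) ⟩
    2 * ⌊ n /2⌋                     ≤⟨ 2*⌊n/2⌋≤n n ⟩
    n                               ∎
    where open ≤-Reasoning

  2^s*m≤n⇒m≤⌊n/2^s⌋ : ∀ s {m n} → 2 ^ s * m ≤ n → m ≤ ⌊ n /2^ s ⌋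
  2^s*m≤n⇒m≤⌊n/2^s⌋ zero    {m} m≤n = ≤-trans (≤-reflexive (sym (+-identityʳ m))) m≤n
  2^s*m≤n⇒m≤⌊n/2^s⌋ (suc s) {m} le  =
    2^s*m≤n⇒m≤⌊n/2^s⌋ s (2*m≤n⇒m≤⌊n/2⌋ (≤-trans (≤-reflexive (sym (*-assoc 2 (2 ^ s) m))) le))

  ν₂[i*2] : ∀ i → ν₂ (suc i * 2) ≡ suc (ν₂ (suc i))
  ν₂[i*2] i = trans (cong ν₂ (*-comm (suc i) 2)) (ν₂-2* {suc i} (s≤s z≤n))

  ∑ν₂≡⌊n/2⌋+∑ν₂⌊n/2⌋ : ∀ n → ∑ ν₂ n ≡ ⌊ n /2⌋ + ∑ ν₂ ⌊ n /2⌋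
  ∑ν₂≡⌊n/2⌋+∑ν₂⌊n/2⌋ n = begin
    ∑ ν₂ n                               ≡⟨ ∑-evens ν₂ ν₂-odd n ⟩
    ∑ (λ i → ν₂ (i * 2)) ⌊ n /2⌋         ≡⟨ ∑-cong ⌊ n /2⌋ (λ i _ → ν₂[i*2] i) ⟩
    ∑ (λ i → 1 + ν₂ i) ⌊ n /2⌋           ≡⟨ ∑-distrib-+ (λ _ → 1) ν₂ ⌊ n /2⌋ ⟩
    ∑ (λ _ → 1) ⌊ n /2⌋ + ∑ ν₂ ⌊ n /2⌋   ≡⟨ cong (_+ ∑ ν₂ ⌊ n /2⌋) (trans (∑-const 1 ⌊ n /2⌋) (*-identityʳ ⌊ n /2⌋)) ⟩
    ⌊ n /2⌋ + ∑ ν₂ ⌊ n /2⌋               ∎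
    where open ≡-Reasoning

  ∑[ν₂∸1+J]≡∑[ν₂∸J]⌊n/2⌋ : ∀ J n → ∑ (λ k → ν₂ k ∸ suc J) n ≡ ∑ (λ k → ν₂ k ∸ J) ⌊ n /2⌋
  ∑[ν₂∸1+J]≡∑[ν₂∸J]⌊n/2⌋ J n = trans (∑-evens (λ k → ν₂ k ∸ suc J) (λ q → cong (_∸ suc J) (ν₂-odd q)) n)
                                      (∑-cong ⌊ n /2⌋ (λ i _ → cong (_∸ suc J) (ν₂[i*2] i)))

  ∑ν₂≤n : ∀ n → ∑ ν₂ n ≤ n
  ∑ν₂≤n = <-rec _ bound
    where
    bound : ∀ n → (∀ {m} → m < n → ∑ ν₂ m ≤ m) → ∑ ν₂ n ≤ n
    bound zero    _   = z≤n
    bound (suc n) rec = begin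
      ∑ ν₂ (suc n)       ≡⟨ ∑ν₂≡⌊n/2⌋+∑ν₂⌊n/2⌋ (suc n) ⟩
      h + ∑ ν₂ h         ≤⟨ +-monoʳ-≤ h (rec (⌊n/2⌋<n n)) ⟩
      h + h              ≡⟨ cong (h +_) (sym (+-identityʳ h)) ⟩
      2 * h              ≤⟨ 2*⌊n/2⌋≤n (suc n) ⟩
      suc n              ∎
      where
      open ≤-Reasoning
      h = ⌊ suc n /2⌋

  2^J*∑[ν₂∸J]≤n : ∀ J n → 2 ^ J * ∑ (λ k → ν₂ k ∸ J) n ≤ n
  2^J*∑[ν₂∸J]≤n zero    n = ≤-trans (≤-reflexive (+-identityʳ _)) (∑ν₂≤n n)
  2^J*∑[ν₂∸J]≤n (suc J) n = begin
    2 * 2 ^ J * ∑ (λ k → ν₂ k ∸ suc J) n    ≡⟨ cong (2 * 2 ^ J *_) (∑[ν₂∸1+J]≡∑[ν₂∸J]⌊n/2⌋ J n) ⟩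
    2 * 2 ^ J * ∑ (λ k → ν₂ k ∸ J) ⌊ n /2⌋  ≡⟨ *-assoc 2 (2 ^ J) _ ⟩
    2 * (2 ^ J * ∑ (λ k → ν₂ k ∸ J) ⌊ n /2⌋) ≤⟨ *-monoʳ-≤ 2 (2^J*∑[ν₂∸J]≤n J ⌊ n /2⌋) ⟩
    2 * ⌊ n /2⌋                             ≤⟨ 2*⌊n/2⌋≤n n ⟩
    n                                       ∎
    where open ≤-Reasoning

  -- n ∸ ∑ ν₂ n is the binary digit sum of n, and the digits beyond the s lowest
  -- contribute at most ⌊n/2^s⌋.
  n≤∑ν₂+s+⌊n/2^s⌋ : ∀ n s → n ≤ ∑ ν₂ n + s + ⌊ n /2^ s ⌋
  n≤∑ν₂+s+⌊n/2^s⌋ n zero    = m≤n+m n (∑ ν₂ n + 0)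
  n≤∑ν₂+s+⌊n/2^s⌋ n (suc s) = begin
    n                                    ≤⟨ n≤1+2*⌊n/2⌋ n ⟩
    suc (2 * h)                          ≡⟨ cong suc (cong (h +_) (+-identityʳ h)) ⟩
    suc (h + h)                          ≤⟨ s≤s (+-monoʳ-≤ h (n≤∑ν₂+s+⌊n/2^s⌋ h s)) ⟩
    suc (h + (∑ ν₂ h + s + ⌊ h /2^ s ⌋)) ≡⟨ regroup h (∑ ν₂ h) s ⌊ h /2^ s ⌋ ⟩
    h + ∑ ν₂ h + suc s + ⌊ h /2^ s ⌋     ≡⟨ cong (λ x → x + suc s + ⌊ h /2^ s ⌋) (sym (∑ν₂≡⌊n/2⌋+∑ν₂⌊n/2⌋ n)) ⟩
    ∑ ν₂ n + suc s + ⌊ n /2^ suc s ⌋     ∎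
    where
    open ≤-Reasoning
    h = ⌊ n /2⌋
    regroup : ∀ a b c d → suc (a + (b + c + d)) ≡ a + b + suc c + d
    regroup = solve-∀

open Legendre

module PrimeCounting where
  open import Data.Nat.Base using (_+_)
  open import Data.Nat.Combinatorics using (k![n∸k]!∣n!)

  π : ℕ → ℕ
  π n = ∑ (λ k → 𝟙 (prime? k)) n

  π≤n : ∀ n → π n ≤ n
  π≤n n = ≤-trans (∑-mono-≤ n (λ k _ → 𝟙≤1 (prime? (suc k))))
                  (≤-reflexive (trans (∑-const 1 n) (*-identityʳ n)))

  π[1+n]≤π[n]+1 : ∀ n → π (suc n) ≤ π n + 1
  π[1+n]≤π[n]+1 n = +-monoʳ-≤ (π n) (𝟙≤1 (prime? (suc n)))

  primeProduct : ℕ → ℕ → ℕ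
  primeProduct m zero    = 1
  primeProduct m (suc i) = (m + suc i) ^ 𝟙 (prime? (m + suc i)) * primeProduct m i

  [1+m]^#primes≤primeProduct : ∀ m i → suc m ^ ∑ (λ k → 𝟙 (prime? (m + k))) i ≤ primeProduct m i
  [1+m]^#primes≤primeProduct m zero    = ≤-refl
  [1+m]^#primes≤primeProduct m (suc i) = begin
    suc m ^ (c + b)         ≡⟨ ^-distribˡ-+-* (suc m) c b ⟩
    suc m ^ c * suc m ^ b   ≤⟨ *-mono-≤ ([1+m]^#primes≤primeProduct m i) (^-monoˡ-≤ b 1+m≤m+1+i) ⟩
    primeProduct m i * (m + suc i) ^ b ≡⟨ *-comm (primeProduct m i) _ ⟩
    primeProduct m (suc i)  ∎
    where
    open ≤-Reasoning
    c = ∑ (λ k → 𝟙 (prime? (m + k))) i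
    b = 𝟙 (prime? (m + suc i))
    1+m≤m+1+i : suc m ≤ m + suc i
    1+m≤m+1+i = subst (_≤ m + suc i) (+-comm m 1) (+-monoʳ-≤ m (s≤s z≤n))

  x^𝟙∣x : ∀ {p} {P : Set p} x (P? : Dec P) → x ^ 𝟙 P? ∣ x
  x^𝟙∣x x (yes _) = ∣-reflexive (*-identityʳ x)
  x^𝟙∣x x (no _)  = 1∣ x

  primeProduct*m!∣[m+i]! : ∀ m i → primeProduct m i * m ! ∣ (m + i) !
  primeProduct*m!∣[m+i]! m zero    =
    subst (λ x → 1 * m ! ∣ x !) (sym (+-identityʳ m)) (∣-reflexive (+-identityʳ (m !)))
  primeProduct*m!∣[m+i]! m (suc i) =
    subst₂ _∣_ (sym (*-assoc f (primeProduct m i) (m !))) (sym [m+1+i]!≡)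
               (*-pres-∣ (x^𝟙∣x (m + suc i) (prime? (m + suc i))) (primeProduct*m!∣[m+i]! m i))
    where
    f = (m + suc i) ^ 𝟙 (prime? (m + suc i))
    [m+1+i]!≡ : (m + suc i) ! ≡ (m + suc i) * (m + i) !
    [m+1+i]!≡ = trans (cong _! (+-suc m i)) (cong (_* (m + i) !) (sym (+-suc m i)))

  primeProduct⊥m! : ∀ m i → Coprime (primeProduct m i) (m !)
  primeProduct⊥m! m zero    = Coprime.1-coprimeTo (m !)
  primeProduct⊥m! m (suc i) =
    Coprime.sym (coprime-*ʳ (Coprime.sym (factor⊥m! (prime? (m + suc i)))) (Coprime.sym (primeProduct⊥m! m i)))
    where
    factor⊥m! : (P? : Dec (Prime (m + suc i))) → Coprime ((m + suc i) ^ 𝟙 P?) (m !)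
    factor⊥m! (yes prime[m+1+i]) =
      subst (λ x → Coprime x (m !)) (sym (*-identityʳ (m + suc i)))
            (prime⇒coprime-! prime[m+1+i] m (subst (m <_) (sym (+-suc m i)) (s≤s (m≤m+n m i))))
    factor⊥m! (no _) = Coprime.1-coprimeTo (m !)

  primeProduct*[m!*m!]∣[m+m]! : ∀ m → primeProduct m m * (m ! * m !) ∣ (m + m) !
  primeProduct*[m!*m!]∣[m+m]! m =
    coprime⇒*-∣ (coprime-*ʳ (primeProduct⊥m! m m) (primeProduct⊥m! m m))
                (∣-trans (m∣m*n (m !)) (primeProduct*m!∣[m+i]! m m))
                (subst (λ x → m ! * x ! ∣ (m + m) !) (m+n∸n≡m m m) (k![n∸k]!∣n! (m≤n+m m m)))

  [m+m]!≤4^m*[m!*m!] : ∀ m → (m + m) ! ≤ 4 ^ m * (m ! * m !)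
  [m+m]!≤4^m*[m!*m!] zero    = ≤-refl
  [m+m]!≤4^m*[m!*m!] (suc m) = begin
    (suc m + suc m) !                                          ≡⟨ cong (λ x → suc x !) (+-suc m m) ⟩
    (2 + m + m) * ((1 + m + m) * (m + m) !)
      ≤⟨ *-monoʳ-≤ (2 + m + m) (*-monoʳ-≤ (1 + m + m) ([m+m]!≤4^m*[m!*m!] m)) ⟩
    (2 + m + m) * ((1 + m + m) * (4 ^ m * (f * f)))            ≤⟨ m≤m+n _ _ ⟩
    (2 + m + m) * ((1 + m + m) * (4 ^ m * (f * f))) + (2 + m + m) * (4 ^ m * (f * f)) ≡⟨ expand m (4 ^ m) f ⟩
    4 * 4 ^ m * ((1 + m) * f * ((1 + m) * f))                  ∎
    where
    open ≤-Reasoning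
    f = m !
    expand : ∀ m p f → (2 + m + m) * ((1 + m + m) * (p * (f * f))) + (2 + m + m) * (p * (f * f)) ≡
                       4 * p * ((1 + m) * f * ((1 + m) * f))
    expand = solve-∀

  primeProduct≤4^m : ∀ m → primeProduct m m ≤ 4 ^ m
  primeProduct≤4^m m = *-cancelʳ-≤ (primeProduct m m) (4 ^ m) (m ! * m !) {{m !* m !≢0}}
    (≤-trans (∣⇒≤ {{(m + m) !≢0}} (primeProduct*[m!*m!]∣[m+m]! m)) ([m+m]!≤4^m*[m!*m!] m))

  2^m≤2^n⇒m≤n : ∀ {m n} → 2 ^ m ≤ 2 ^ n → m ≤ n
  2^m≤2^n⇒m≤n {m} {n} 2^m≤2^n with m ≤? n
  ... | yes m≤n = m≤n
  ... | no m≰n  = ⊥-elim (<⇒≱ (^-monoʳ-< 2 (s≤s (s≤s z≤n)) (≰⇒> m≰n)) 2^m≤2^n)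

  -- The primes in (m, 2m] divide the central binomial coefficient, which is at most 4^m.
  2^t≤m⇒t*π[2m]≤t*π[m]+2m : ∀ t m → 2 ^ t ≤ m → t * π (m + m) ≤ t * π m + 2 * m
  2^t≤m⇒t*π[2m]≤t*π[m]+2m t m 2^t≤m = begin
    t * π (m + m)           ≡⟨ cong (t *_) (∑-+ _ m m) ⟩
    t * (π m + c)           ≡⟨ *-distribˡ-+ t (π m) c ⟩
    t * π m + t * c         ≤⟨ +-monoʳ-≤ (t * π m) (2^m≤2^n⇒m≤n 2^[t*c]≤2^[2m]) ⟩
    t * π m + 2 * m         ∎
    where
    open ≤-Reasoning
    c = ∑ (λ k → 𝟙 (prime? (m + k))) m
    2^[t*c]≤2^[2m] : 2 ^ (t * c) ≤ 2 ^ (2 * m)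
    2^[t*c]≤2^[2m] = begin
      2 ^ (t * c)         ≡⟨ ^-*-assoc 2 t c ⟨
      (2 ^ t) ^ c         ≤⟨ ^-monoˡ-≤ c (m≤n⇒m≤1+n 2^t≤m) ⟩
      suc m ^ c           ≤⟨ [1+m]^#primes≤primeProduct m m ⟩
      primeProduct m m    ≤⟨ primeProduct≤4^m m ⟩
      4 ^ m               ≡⟨ ^-*-assoc 2 2 m ⟩
      2 ^ (2 * m)         ∎

  t*π[n]≤t*π[⌊n/2⌋]+2⌊n/2⌋+t : ∀ t n → 2 ^ t ≤ ⌊ n /2⌋ → t * π n ≤ t * π ⌊ n /2⌋ + 2 * ⌊ n /2⌋ + t
  t*π[n]≤t*π[⌊n/2⌋]+2⌊n/2⌋+t t n 2^t≤h = begin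
    t * π n                 ≤⟨ *-monoʳ-≤ t (∑-monoʳ-≤ _ (n≤1+2*⌊n/2⌋ n)) ⟩
    t * π (suc (2 * h))     ≤⟨ *-monoʳ-≤ t (π[1+n]≤π[n]+1 (2 * h)) ⟩
    t * (π (2 * h) + 1)     ≡⟨ cong (λ x → t * (π x + 1)) (cong (h +_) (+-identityʳ h)) ⟩
    t * (π (h + h) + 1)     ≡⟨ *-distribˡ-+ t (π (h + h)) 1 ⟩
    t * π (h + h) + t * 1   ≤⟨ +-mono-≤ (2^t≤m⇒t*π[2m]≤t*π[m]+2m t h 2^t≤h) (≤-reflexive (*-identityʳ t)) ⟩
    t * π h + 2 * h + t     ∎
    where
    open ≤-Reasoning
    h = ⌊ n /2⌋

  -- The term 2 ⌊n/2^s⌋ on the left lets the sum 2 (⌊n/2⌋ + ⌊n/4⌋ + ⋯) telescope.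
  t*π[n]≤t*⌊n/2^s⌋+2n+ts : ∀ t s n → 2 ^ t ≤ ⌊ n /2^ s ⌋ →
                           t * π n + 2 * ⌊ n /2^ s ⌋ ≤ t * ⌊ n /2^ s ⌋ + 2 * n + t * s
  t*π[n]≤t*⌊n/2^s⌋+2n+ts t zero n _ = begin
    t * π n + 2 * n             ≤⟨ +-monoˡ-≤ (2 * n) (*-monoʳ-≤ t (π≤n n)) ⟩
    t * n + 2 * n               ≡⟨ sym (+-identityʳ _) ⟩
    t * n + 2 * n + 0           ≡⟨ cong (t * n + 2 * n +_) (sym (*-zeroʳ t)) ⟩
    t * n + 2 * n + t * 0       ∎
    where open ≤-Reasoning
  t*π[n]≤t*⌊n/2^s⌋+2n+ts t (suc s) n 2^t≤q = begin
    t * π n + 2 * q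
      ≤⟨ +-monoˡ-≤ (2 * q) (t*π[n]≤t*π[⌊n/2⌋]+2⌊n/2⌋+t t n (≤-trans 2^t≤q (⌊n/2^s⌋≤n h s))) ⟩
    t * π h + 2 * h + t + 2 * q              ≡⟨ regroup (t * π h) (2 * h) t (2 * q) ⟩
    t * π h + 2 * q + (2 * h + t)            ≤⟨ +-monoˡ-≤ (2 * h + t) (t*π[n]≤t*⌊n/2^s⌋+2n+ts t s h 2^t≤q) ⟩
    t * q + 2 * h + t * s + (2 * h + t)      ≡⟨ collect (t * q) h t s ⟩
    t * q + 2 * (2 * h) + t * suc s          ≤⟨ +-monoˡ-≤ (t * suc s) (+-monoʳ-≤ (t * q) (*-monoʳ-≤ 2 (2*⌊n/2⌋≤n n))) ⟩
    t * q + 2 * n + t * suc s                ∎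
    where
    open ≤-Reasoning
    h = ⌊ n /2⌋
    q = ⌊ h /2^ s ⌋
    regroup : ∀ a b c d → a + b + c + d ≡ a + d + (b + c)
    regroup = solve-∀
    collect : ∀ x h t s → x + 2 * h + t * s + (2 * h + t) ≡ x + 2 * (2 * h) + t * (1 + s)
    collect = solve-∀

  -- Take s = t = 4 (M + 1): once n ≥ 4^t + t², the right-hand side t ⌊n/2^t⌋ + 2n + t²
  -- is at most 4n, so 4 (M + 1) π(n) ≤ 4n.
  π-sublinear : ∀ M → ∃ λ N → ∀ n → N ≤ n → M * π n ≤ n
  π-sublinear M = 2 ^ t * 2 ^ t + t * t , bound
    where
    t = 4 * suc M
    bound : ∀ n → 2 ^ t * 2 ^ t + t * t ≤ n → M * π n ≤ n
    bound n N≤n = ≤-trans (*-monoˡ-≤ (π n) (n≤1+n M)) (*-cancelˡ-≤ 4 (begin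
      4 * (suc M * π n)        ≡⟨ sym (*-assoc 4 (suc M) (π n)) ⟩
      t * π n                  ≤⟨ m≤m+n (t * π n) (2 * q) ⟩
      t * π n + 2 * q          ≤⟨ t*π[n]≤t*⌊n/2^s⌋+2n+ts t t n (2^s*m≤n⇒m≤⌊n/2^s⌋ t (≤-trans (m≤m+n _ _) N≤n)) ⟩
      t * q + 2 * n + t * t    ≤⟨ +-mono-≤ (+-monoˡ-≤ (2 * n) t*q≤n) (≤-trans (m≤n+m _ _) N≤n) ⟩
      n + 2 * n + n            ≡⟨ collect n ⟩
      4 * n                    ∎))
      where
      open ≤-Reasoning
      q = ⌊ n /2^ t ⌋
      t*q≤n : t * q ≤ n
      t*q≤n = ≤-trans (*-monoˡ-≤ q (<⇒≤ (n<2^n t))) (2^s*⌊n/2^s⌋≤n n t)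
      collect : ∀ n → n + 2 * n + n ≡ 4 * n
      collect = solve-∀

open PrimeCounting

module ValuationOfTotient where
  open import Data.Nat.Base using (_+_)

  prime⇒1≤p∸1 : ∀ {p} → Prime p → 1 ≤ p ∸ 1
  prime⇒1≤p∸1 {suc (suc _)} _ = s≤s z≤n

  1≤[1+k]∸𝟙[prime] : ∀ k → 1 ≤ suc k ∸ 𝟙 (prime? (suc k))
  1≤[1+k]∸𝟙[prime] k with prime? (suc k)
  ... | yes [1+k]-prime = prime⇒1≤p∸1 [1+k]-prime
  ... | no _            = s≤s z≤n

  1≤φ! : ∀ n → 1 ≤ φ! n
  1≤φ! zero    = s≤s z≤n
  1≤φ! (suc n) = *-mono-≤ (1≤[1+k]∸𝟙[prime] n) (1≤φ! n)

  ν₂[φ!]≡∑ : ∀ n → ν₂ (φ! n) ≡ ∑ (λ k → ν₂ (k ∸ 𝟙 (prime? k))) n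
  ν₂[φ!]≡∑ zero    = refl
  ν₂[φ!]≡∑ (suc n) = begin
    ν₂ (f * φ! n)        ≡⟨ ν₂-* (1≤[1+k]∸𝟙[prime] n) (1≤φ! n) ⟩
    ν₂ f + ν₂ (φ! n)     ≡⟨ +-comm (ν₂ f) _ ⟩
    ν₂ (φ! n) + ν₂ f     ≡⟨ cong (_+ ν₂ f) (ν₂[φ!]≡∑ n) ⟩
    ∑ (λ k → ν₂ (k ∸ 𝟙 (prime? k))) (suc n) ∎
    where
    open ≡-Reasoning
    f = suc n ∸ 𝟙 (prime? (suc n))

  odd-prime⇒ν₂≡0 : ∀ {p} → Prime p → p ≢ 2 → ν₂ p ≡ 0
  odd-prime⇒ν₂≡0 {p} p-prime p≢2 with even⊎odd p
  ... | inj₂ odd  = trans (cong ν₂ odd) (ν₂-odd ⌊ p /2⌋)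
  ... | inj₁ even with prime⇒irreducible p-prime (divides ⌊ p /2⌋ (trans even (*-comm 2 ⌊ p /2⌋)))
  ...   | inj₁ ()
  ...   | inj₂ 2≡p = ⊥-elim (p≢2 (sym 2≡p))

  ν₂≤ν₂[k∸𝟙[prime]]+𝟙[k≡2] : ∀ k → ν₂ k ≤ ν₂ (k ∸ 𝟙 (prime? k)) + 𝟙 (k ≟ 2)
  ν₂≤ν₂[k∸𝟙[prime]]+𝟙[k≡2] k with prime? k
  ... | no _ = m≤m+n (ν₂ k) _
  ... | yes k-prime with k ≟ 2
  ...   | yes refl = s≤s z≤n
  ...   | no k≢2   = ≤-trans (≤-reflexive (odd-prime⇒ν₂≡0 k-prime k≢2)) z≤n

  ∑𝟙[k≡2]≤1 : ∀ n → ∑ (λ k → 𝟙 (k ≟ 2)) n ≤ 1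
  ∑𝟙[k≡2]≤1 zero                = z≤n
  ∑𝟙[k≡2]≤1 (suc zero)          = z≤n
  ∑𝟙[k≡2]≤1 (suc (suc zero))    = ≤-refl
  ∑𝟙[k≡2]≤1 (suc (suc (suc n))) = ≤-trans (≤-reflexive (+-identityʳ _)) (∑𝟙[k≡2]≤1 (suc (suc n)))

  ∑ν₂≤ν₂[φ!]+1 : ∀ n → ∑ ν₂ n ≤ ν₂ (φ! n) + 1
  ∑ν₂≤ν₂[φ!]+1 n = begin
    ∑ ν₂ n                                        ≤⟨ ∑-mono-≤ n (λ k _ → ν₂≤ν₂[k∸𝟙[prime]]+𝟙[k≡2] (suc k)) ⟩
    ∑ (λ k → ν₂ (k ∸ 𝟙 (prime? k)) + 𝟙 (k ≟ 2)) n ≡⟨ ∑-distrib-+ _ _ n ⟩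
    ∑ (λ k → ν₂ (k ∸ 𝟙 (prime? k))) n + ∑ (λ k → 𝟙 (k ≟ 2)) n
                                                  ≤⟨ +-mono-≤ (≤-reflexive (sym (ν₂[φ!]≡∑ n))) (∑𝟙[k≡2]≤1 n) ⟩
    ν₂ (φ! n) + 1                                 ∎
    where open ≤-Reasoning

  ν₂[∏p∸1] : ℕ → ℕ
  ν₂[∏p∸1] n = ∑ (λ k → 𝟙 (prime? k) * ν₂ (k ∸ 1)) n

  ν₂[k∸𝟙[prime]]≤ν₂+𝟙[prime]*ν₂[k∸1] : ∀ k → ν₂ (k ∸ 𝟙 (prime? k)) ≤ ν₂ k + 𝟙 (prime? k) * ν₂ (k ∸ 1)
  ν₂[k∸𝟙[prime]]≤ν₂+𝟙[prime]*ν₂[k∸1] k with prime? k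
  ... | yes _ = ≤-trans (≤-reflexive (sym (+-identityʳ _))) (m≤n+m _ (ν₂ k))
  ... | no _  = m≤m+n (ν₂ k) 0

  ν₂[φ!]≤∑ν₂+ν₂[∏p∸1] : ∀ n → ν₂ (φ! n) ≤ ∑ ν₂ n + ν₂[∏p∸1] n
  ν₂[φ!]≤∑ν₂+ν₂[∏p∸1] n = begin
    ν₂ (φ! n)                                          ≡⟨ ν₂[φ!]≡∑ n ⟩
    ∑ (λ k → ν₂ (k ∸ 𝟙 (prime? k))) n                  ≤⟨ ∑-mono-≤ n (λ k _ → ν₂[k∸𝟙[prime]]≤ν₂+𝟙[prime]*ν₂[k∸1] (suc k)) ⟩
    ∑ (λ k → ν₂ k + 𝟙 (prime? k) * ν₂ (k ∸ 1)) n       ≡⟨ ∑-distrib-+ ν₂ _ n ⟩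
    ∑ ν₂ n + ν₂[∏p∸1] n                                ∎
    where open ≤-Reasoning

  -- Split each ν₂(p − 1) at the threshold J: the part below J is paid by π,
  -- the excess over J by the dyadic bound 2^J ∑ (ν₂ k ∸ J) ≤ n.
  ν₂[∏p∸1]≤J*π+∑[ν₂∸J] : ∀ J n → ν₂[∏p∸1] n ≤ J * π n + ∑ (λ k → ν₂ k ∸ J) n
  ν₂[∏p∸1]≤J*π+∑[ν₂∸J] J n = begin
    ν₂[∏p∸1] n                                               ≤⟨ ∑-mono-≤ n (λ k _ → split (suc k)) ⟩
    ∑ (λ k → J * 𝟙 (prime? k) + (ν₂ (k ∸ 1) ∸ J)) n          ≡⟨ ∑-distrib-+ _ _ n ⟩
    ∑ (λ k → J * 𝟙 (prime? k)) n + ∑ (λ k → ν₂ (k ∸ 1) ∸ J) n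
      ≡⟨ cong (_+ ∑ (λ k → ν₂ (k ∸ 1) ∸ J) n) (∑-distribˡ-* J _ n) ⟩
    J * π n + ∑ (λ k → ν₂ (k ∸ 1) ∸ J) n                     ≤⟨ +-monoʳ-≤ (J * π n) (shift n) ⟩
    J * π n + ∑ (λ k → ν₂ k ∸ J) n                           ∎
    where
    open ≤-Reasoning
    split : ∀ k → 𝟙 (prime? k) * ν₂ (k ∸ 1) ≤ J * 𝟙 (prime? k) + (ν₂ (k ∸ 1) ∸ J)
    split k with prime? k
    ... | yes _ = ≤-trans (≤-reflexive (+-identityʳ _))
                          (≤-trans (m≤n+m∸n (ν₂ (k ∸ 1)) J) (+-monoˡ-≤ _ (≤-reflexive (sym (*-identityʳ J)))))
    ... | no _  = z≤n
    shift : ∀ n → ∑ (λ k → ν₂ (k ∸ 1) ∸ J) n ≤ ∑ (λ k → ν₂ k ∸ J) n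
    shift zero    = z≤n
    shift (suc n) = begin
      ∑ (λ k → ν₂ (k ∸ 1) ∸ J) (suc n)   ≡⟨ ∑-pred (λ k → ν₂ k ∸ J) n ⟩
      (0 ∸ J) + ∑ (λ k → ν₂ k ∸ J) n     ≡⟨ cong (_+ ∑ (λ k → ν₂ k ∸ J) n) (0∸n≡0 J) ⟩
      ∑ (λ k → ν₂ k ∸ J) n               ≤⟨ ∑-monoʳ-≤ (λ k → ν₂ k ∸ J) (n≤1+n n) ⟩
      ∑ (λ k → ν₂ k ∸ J) (suc n)         ∎

open ValuationOfTotient

module LowerBound where
  open import Data.Nat.Base using (_+_)

  ν₂[∏p∸1]-sublinear : ∀ K → ∃ λ N → ∀ n → N ≤ n → K * ν₂[∏p∸1] n ≤ n
  ν₂[∏p∸1]-sublinear K = N , bound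
    where
    J = 2 * K
    N = proj₁ (π-sublinear (2 * K * J))
    bound : ∀ n → N ≤ n → K * ν₂[∏p∸1] n ≤ n
    bound n N≤n = *-cancelˡ-≤ 2 (begin
      2 * (K * ν₂[∏p∸1] n)                               ≡⟨ sym (*-assoc 2 K _) ⟩
      2 * K * ν₂[∏p∸1] n                                 ≤⟨ *-monoʳ-≤ (2 * K) (ν₂[∏p∸1]≤J*π+∑[ν₂∸J] J n) ⟩
      2 * K * (J * π n + ∑ (λ k → ν₂ k ∸ J) n)           ≡⟨ distribute (2 * K) J (π n) _ ⟩
      2 * K * J * π n + 2 * K * ∑ (λ k → ν₂ k ∸ J) n
        ≤⟨ +-mono-≤ (proj₂ (π-sublinear (2 * K * J)) n N≤n)
                    (≤-trans (*-monoˡ-≤ _ (<⇒≤ (n<2^n J))) (2^J*∑[ν₂∸J]≤n J n)) ⟩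
      n + n                                              ≡⟨ cong (n +_) (sym (+-identityʳ n)) ⟩
      2 * n                                              ∎)
      where
      open ≤-Reasoning
      distribute : ∀ a b c d → a * (b * c + d) ≡ a * b * c + a * d
      distribute = solve-∀

  slack : ℕ → ℕ → ℕ
  slack s n = 1 + s + ⌊ n /2^ s ⌋

  slack-sublinear : ∀ K → ∃₂ λ s N → ∀ n → N ≤ n → 2 * K * slack s n ≤ n
  slack-sublinear K = s , 4 * K * (1 + s) , bound
    where
    s = 4 * K
    bound : ∀ n → 4 * K * (1 + s) ≤ n → 2 * K * slack s n ≤ n
    bound n N≤n = *-cancelˡ-≤ 2 (begin
      2 * (2 * K * (1 + s + ⌊ n /2^ s ⌋))                ≡⟨ distribute K (1 + s) ⌊ n /2^ s ⌋ ⟩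
      4 * K * (1 + s) + 4 * K * ⌊ n /2^ s ⌋
        ≤⟨ +-mono-≤ N≤n (≤-trans (*-monoˡ-≤ _ (<⇒≤ (n<2^n s))) (2^s*⌊n/2^s⌋≤n n s)) ⟩
      n + n                                              ≡⟨ cong (n +_) (sym (+-identityʳ n)) ⟩
      2 * n                                              ∎)
      where
      open ≤-Reasoning
      distribute : ∀ K a h → 2 * (2 * K * (a + h)) ≡ 4 * K * a + 4 * K * h
      distribute = solve-∀

  n≤ν₂[φ!]+slack : ∀ s n → n ≤ ν₂ (φ! n) + slack s n
  n≤ν₂[φ!]+slack s n = begin
    n                                  ≤⟨ n≤∑ν₂+s+⌊n/2^s⌋ n s ⟩
    ∑ ν₂ n + s + ⌊ n /2^ s ⌋           ≤⟨ +-monoˡ-≤ ⌊ n /2^ s ⌋ (+-monoˡ-≤ s (∑ν₂≤ν₂[φ!]+1 n)) ⟩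
    ν₂ (φ! n) + 1 + s + ⌊ n /2^ s ⌋    ≡⟨ regroup (ν₂ (φ! n)) s ⌊ n /2^ s ⌋ ⟩
    ν₂ (φ! n) + slack s n              ∎
    where
    open ≤-Reasoning
    regroup : ∀ e s h → e + 1 + s + h ≡ e + (1 + s + h)
    regroup = solve-∀

  -- Comparing 2-adic valuations: ν₂(φ(a!)) ≈ a, while ν₂(φ(c!)) ≤ c + ν₂ ∏_{p ≤ c} (p − 1).
  φ!∣φ!⇒a+b≤c+ν₂[∏p∸1]+slack : ∀ s {a b c} → φ! a * φ! b ∣ φ! c →
                                a + b ≤ c + ν₂[∏p∸1] c + (slack s a + slack s b)
  φ!∣φ!⇒a+b≤c+ν₂[∏p∸1]+slack s {a} {b} {c} φ!a*φ!b∣φ!c = begin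
    a + b                                           ≤⟨ +-mono-≤ (n≤ν₂[φ!]+slack s a) (n≤ν₂[φ!]+slack s b) ⟩
    ν₂ (φ! a) + slack s a + (ν₂ (φ! b) + slack s b) ≡⟨ swap (ν₂ (φ! a)) (slack s a) (ν₂ (φ! b)) (slack s b) ⟩
    ν₂ (φ! a) + ν₂ (φ! b) + (slack s a + slack s b) ≤⟨ +-monoˡ-≤ _ ν₂[φ!a]+ν₂[φ!b]≤ν₂[φ!c] ⟩
    ν₂ (φ! c) + (slack s a + slack s b)             ≤⟨ +-monoˡ-≤ _ (ν₂[φ!]≤∑ν₂+ν₂[∏p∸1] c) ⟩
    ∑ ν₂ c + ν₂[∏p∸1] c + (slack s a + slack s b)   ≤⟨ +-monoˡ-≤ _ (+-monoˡ-≤ _ (∑ν₂≤n c)) ⟩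
    c + ν₂[∏p∸1] c + (slack s a + slack s b)        ∎
    where
    open ≤-Reasoning
    swap : ∀ a b c d → a + b + (c + d) ≡ a + c + (b + d)
    swap = solve-∀
    ν₂[φ!a]+ν₂[φ!b]≤ν₂[φ!c] : ν₂ (φ! a) + ν₂ (φ! b) ≤ ν₂ (φ! c)
    ν₂[φ!a]+ν₂[φ!b]≤ν₂[φ!c] = ≤-trans (≤-reflexive (sym (ν₂-* (1≤φ! a) (1≤φ! b)))) (ν₂-mono-∣ (1≤φ! c) φ!a*φ!b∣φ!c)

  K*[x+y+z]≤m+n : ∀ K {x y z m n} → 2 * K * x ≤ m + n → 2 * K * y ≤ m → 2 * K * z ≤ n →
                  K * (x + (y + z)) ≤ m + n
  K*[x+y+z]≤m+n K {x} {y} {z} {m} {n} x-small y-small z-small = *-cancelˡ-≤ 2 (begin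
    2 * (K * (x + (y + z)))                   ≡⟨ distribute K x y z ⟩
    2 * K * x + (2 * K * y + 2 * K * z)       ≤⟨ +-mono-≤ x-small (+-mono-≤ y-small z-small) ⟩
    m + n + (m + n)                           ≡⟨ cong (m + n +_) (sym (+-identityʳ (m + n))) ⟩
    2 * (m + n)                               ∎)
    where
    open ≤-Reasoning
    distribute : ∀ K x y z → 2 * (K * (x + (y + z))) ≡ 2 * K * x + (2 * K * y + 2 * K * z)
    distribute = solve-∀

  -- K (a + b) ≤ K c + (a + b) is c ≥ (1 − 1/K)(a + b) with the subtraction moved across.
  φ!∣φ!⇒c≥[1-1/K][a+b] : ∀ K → ∃ λ N → ∀ a b c → N ≤ a → N ≤ b → φ! a * φ! b ∣ φ! c →
                         K * (a + b) ≤ K * c + (a + b)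
  φ!∣φ!⇒c≥[1-1/K][a+b] K = N₁ + N₂ , bound
    where
    s = proj₁ (slack-sublinear K)
    N₁ = proj₁ (proj₂ (slack-sublinear K))
    N₂ = proj₁ (ν₂[∏p∸1]-sublinear (2 * K))
    bound : ∀ a b c → N₁ + N₂ ≤ a → N₁ + N₂ ≤ b → φ! a * φ! b ∣ φ! c → K * (a + b) ≤ K * c + (a + b)
    bound a b c N≤a N≤b φ!a*φ!b∣φ!c with a + b ≤? c
    ... | yes a+b≤c = ≤-trans (*-monoʳ-≤ K a+b≤c) (m≤m+n _ _)
    ... | no a+b≰c  = begin
      K * (a + b)                                           ≤⟨ *-monoʳ-≤ K a+b≤ ⟩
      K * (c + (W + (slack s a + slack s b)))               ≡⟨ *-distribˡ-+ K c _ ⟩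
      K * c + K * (W + (slack s a + slack s b))
        ≤⟨ +-monoʳ-≤ (K * c) (K*[x+y+z]≤m+n K W-small (slack-small a N≤a) (slack-small b N≤b)) ⟩
      K * c + (a + b)                                       ∎
      where
      open ≤-Reasoning
      W = ν₂[∏p∸1] (a + b)
      a+b≤ : a + b ≤ c + (W + (slack s a + slack s b))
      a+b≤ = begin
        a + b                                       ≤⟨ φ!∣φ!⇒a+b≤c+ν₂[∏p∸1]+slack s {a} {b} {c} φ!a*φ!b∣φ!c ⟩
        c + ν₂[∏p∸1] c + (slack s a + slack s b)    ≤⟨ +-monoˡ-≤ _ (+-monoʳ-≤ c (∑-monoʳ-≤ _ (<⇒≤ (≰⇒> a+b≰c)))) ⟩
        c + W + (slack s a + slack s b)             ≡⟨ +-assoc c W _ ⟩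
        c + (W + (slack s a + slack s b))           ∎
      W-small : 2 * K * W ≤ a + b
      W-small = proj₂ (ν₂[∏p∸1]-sublinear (2 * K)) (a + b) (≤-trans (m≤n+m N₂ N₁) (≤-trans N≤a (m≤m+n a b)))
      slack-small : ∀ x → N₁ + N₂ ≤ x → 2 * K * slack s x ≤ x
      slack-small x N≤x = proj₂ (proj₂ (slack-sublinear K)) x (≤-trans (m≤m+n N₁ N₂) N≤x)

open LowerBound

module UpperBound where
  open import Data.Nat.Base using (_+_)

  IsC-below : ∀ a b w → 0 < w → φ (a !) * φ (b !) ∣ φ (w !) → ∃ λ c → c ≤ w × IsC a b c
  IsC-below a b w 0<w φ∣φ with leastWitness (λ c → (0 <? c) ×-dec (φ (a !) * φ (b !) ∣? φ (c !))) (0<w , φ∣φ)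
  ... | c , c≤w , (0<c , φ∣φc) , minimal = c , c≤w , 0<c , φ∣φc , λ c′ 0<c′ φ∣φc′ → minimal c′ (0<c′ , φ∣φc′)

  ¬prime[2*x] : ∀ {x} → 2 ≤ x → ¬ Prime (2 * x)
  ¬prime[2*x] {x} 2≤x 2x-prime with prime⇒irreducible 2x-prime (m∣m*n {2} x)
  ... | inj₁ ()
  ... | inj₂ 2≡2x = <⇒≢ (≤-trans (s≤s (s≤s (s≤s z≤n))) (*-monoʳ-≤ 2 2≤x)) 2≡2x

  even⇒φ![1+n]≡[1+n]*φ![n] : ∀ {n x} → suc n ≡ 2 * x → 2 ≤ x → φ! (suc n) ≡ suc n * φ! n
  even⇒φ![1+n]≡[1+n]*φ![n] {n} 1+n≡2x 2≤x with prime? (suc n)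
  ... | no _           = refl
  ... | yes [1+n]-prime = ⊥-elim (¬prime[2*x] 2≤x (subst Prime 1+n≡2x [1+n]-prime))

  -- b = N + 1 and a = 2 φ!(b) (N + 2) − 1: then a + 1 is even, hence not prime, so
  -- φ((a+1)!) = (a + 1) φ(a!), and φ!(b) divides a + 1.
  c≤a+b-infinitelyOften : ∀ N → ∃ λ a → ∃ λ b → ∃ λ c →
                          1 ≤ a × 1 ≤ b × N ≤ a × N ≤ b × IsC a b c × c ≤ a + b
  c≤a+b-infinitelyOften N = a , b , c , 1≤a , s≤s z≤n , N≤a , n≤1+n N , isC , c≤a+b
    where
    b = suc N
    Y = φ! b * suc (suc N)
    a = 2 * Y ∸ 1
    2+N≤Y : suc (suc N) ≤ Y
    2+N≤Y = m≤n*m (suc (suc N)) (φ! b) {{>-nonZero (1≤φ! b)}}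
    2≤Y : 2 ≤ Y
    2≤Y = ≤-trans (s≤s (s≤s z≤n)) 2+N≤Y
    1+a≡2Y : suc a ≡ 2 * Y
    1+a≡2Y = trans (+-comm 1 a) (m∸n+n≡m (≤-trans (s≤s z≤n) (*-monoʳ-≤ 2 2≤Y)))
    1+N≤a : suc N ≤ a
    1+N≤a = ≤-pred (≤-trans 2+N≤Y (≤-trans (m≤m+n Y (Y + 0)) (≤-reflexive (sym 1+a≡2Y))))
    N≤a : N ≤ a
    N≤a = ≤-trans (n≤1+n N) 1+N≤a
    1≤a : 1 ≤ a
    1≤a = ≤-trans (s≤s z≤n) 1+N≤a
    φ!b∣1+a : φ! b ∣ suc a
    φ!b∣1+a = subst (φ! b ∣_) (sym 1+a≡2Y) (∣-trans (m∣m*n (suc (suc N))) (n∣m*n 2))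
    φ∣φ : φ (a !) * φ (b !) ∣ φ (suc a !)
    φ∣φ = subst₂ _∣_ (sym (cong₂ _*_ (φ[n!]≡φ! a) (φ[n!]≡φ! b)))
                     (sym (trans (φ[n!]≡φ! (suc a)) (even⇒φ![1+n]≡[1+n]*φ![n] 1+a≡2Y 2≤Y)))
                     (subst (φ! a * φ! b ∣_) (*-comm (φ! a) (suc a)) (*-monoʳ-∣ (φ! a) φ!b∣1+a))
    least = IsC-below a b (suc a) (s≤s z≤n) φ∣φ
    c = proj₁ least
    isC = proj₂ (proj₂ least)
    c≤a+b : c ≤ a + b
    c≤a+b = ≤-trans (proj₁ (proj₂ least)) (subst (_≤ a + b) (+-comm a 1) (+-monoʳ-≤ a (s≤s z≤n)))

open UpperBound

module RationalBounds where
  open import Data.Nat.Base using (_+_)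
  open import Data.Integer.Base as ℤ using (+_; -[1+_]; +[1+_])
  import Data.Integer.Properties as ℤₚ
  import Data.Integer.Tactic.RingSolver as ℤ-Solver
  open import Data.Rational.Base as ℚ using (ℚ; mkℚ; 0ℚ; 1ℚ; ↧ₙ_)
  import Data.Rational.Properties as ℚₚ
  import Data.Rational.Unnormalised.Base as ℚᵘ
  import Data.Rational.Unnormalised.Properties as ℚᵘₚ

  Q*d<c*Q+P*d : ∀ {P Q c d} → 1 ≤ P → 1 ≤ d → 2 * Q * d ≤ 2 * Q * c + d → Q * d < c * Q + P * d
  Q*d<c*Q+P*d {P} {Q} {c} {d} 1≤P 1≤d 2Qd≤2Qc+d = *-cancelˡ-< 2 _ _ (begin-strict
    2 * (Q * d)               ≡⟨ sym (*-assoc 2 Q d) ⟩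
    2 * Q * d                 ≤⟨ 2Qd≤2Qc+d ⟩
    2 * Q * c + d             <⟨ +-monoʳ-< (2 * Q * c) d<2Pd ⟩
    2 * Q * c + 2 * (P * d)   ≡⟨ regroup Q c (P * d) ⟩
    2 * (c * Q + P * d)       ∎)
    where
    open ≤-Reasoning
    regroup : ∀ Q c x → 2 * Q * c + 2 * x ≡ 2 * (c * Q + x)
    regroup = solve-∀
    d≤Pd : d ≤ P * d
    d≤Pd = m≤n*m d P {{>-nonZero 1≤P}}
    d<2Pd : d < 2 * (P * d)
    d<2Pd = <-≤-trans (m<m+n d (<-≤-trans 1≤d d≤Pd)) (+-mono-≤ d≤Pd (≤-reflexive (sym (+-identityʳ _))))

  +a-+b<+c : ∀ {a b c} → a < c + b → + a ℤ.- + b ℤ.< + c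
  +a-+b<+c {a} {b} {c} a<c+b = subst (+ a ℤ.- + b ℤ.<_) c+b-b≡c (ℤₚ.+-monoˡ-< (ℤ.- + b) (ℤ.+<+ a<c+b))
    where
    c+b-b≡c : + (c + b) ℤ.- + b ≡ + c
    c+b-b≡c = trans (cong (ℤ._- + b) (ℤₚ.pos-+ c b)) (cancel (+ c) (+ b))
      where
      cancel : ∀ x y → (x ℤ.+ y) ℤ.- y ≡ x
      cancel = ℤ-Solver.solve-∀

  -- The left-hand sides below are, definitionally, ↥ (1 ∓ ε) ↧ (c/d) for ε = (1+p)/Q
  -- as unnormalised rationals, and the right-hand sides ↥ (c/d) ↧ (1 ∓ ε).
  1-ε-cross : ∀ p Q c d → Q * d < c * Q + suc p * d →
              (+ 1 ℤ.* + Q ℤ.+ -[1+ p ] ℤ.* + 1) ℤ.* + d ℤ.< + c ℤ.* + (1 * Q)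
  1-ε-cross p Q c d Qd<cQ+Pd = subst₂ ℤ._<_ (sym expand) +cQ≡+c*+[1*Q] (+a-+b<+c Qd<cQ+Pd)
    where
    +cQ≡+c*+[1*Q] : + (c * Q) ≡ + c ℤ.* + (1 * Q)
    +cQ≡+c*+[1*Q] = trans (cong (λ x → + (c * x)) (sym (*-identityˡ Q))) (ℤₚ.pos-* c (1 * Q))
    distribute : ∀ x y z → (+ 1 ℤ.* x ℤ.+ (ℤ.- z) ℤ.* + 1) ℤ.* y ≡ x ℤ.* y ℤ.- z ℤ.* y
    distribute = ℤ-Solver.solve-∀
    expand : (+ 1 ℤ.* + Q ℤ.+ -[1+ p ] ℤ.* + 1) ℤ.* + d ≡ + (Q * d) ℤ.- + (suc p * d)
    expand = trans (distribute (+ Q) (+ d) (+ suc p)) (sym (cong₂ ℤ._-_ (ℤₚ.pos-* Q d) (ℤₚ.pos-* (suc p) d)))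

  1+ε-cross : ∀ p Q c d → 1 ≤ d → c ≤ d →
              + c ℤ.* + (1 * Q) ℤ.< (+ 1 ℤ.* + Q ℤ.+ + suc p ℤ.* + 1) ℤ.* + d
  1+ε-cross p Q c d 1≤d c≤d = subst₂ ℤ._<_ (ℤₚ.pos-* c (1 * Q)) (sym expand) (ℤ.+<+ cQ<[Q+P]d)
    where
    collect : ∀ x y → + 1 ℤ.* x ℤ.+ y ℤ.* + 1 ≡ x ℤ.+ y
    collect = ℤ-Solver.solve-∀
    expand : (+ 1 ℤ.* + Q ℤ.+ + suc p ℤ.* + 1) ℤ.* + d ≡ + ((Q + suc p) * d)
    expand = trans (cong (ℤ._* + d) (collect (+ Q) (+ suc p))) (sym (ℤₚ.pos-* (Q + suc p) d))
    cQ<[Q+P]d : c * (1 * Q) < (Q + suc p) * d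
    cQ<[Q+P]d = begin-strict
      c * (1 * Q)         ≡⟨ cong (c *_) (*-identityˡ Q) ⟩
      c * Q               ≤⟨ *-monoˡ-≤ Q c≤d ⟩
      d * Q               ≡⟨ *-comm d Q ⟩
      Q * d               <⟨ m<m+n (Q * d) (<-≤-trans 1≤d (m≤m+n d (p * d))) ⟩
      Q * d + suc p * d   ≡⟨ sym (*-distribʳ-+ d Q (suc p)) ⟩
      (Q + suc p) * d     ∎
      where open ≤-Reasoning

  1-ε<c/[1+m] : ∀ ε → 0ℚ ℚ.< ε → ∀ c m → 2 * ↧ₙ ε * suc m ≤ 2 * ↧ₙ ε * c + suc m →
                1ℚ ℚ.- ε ℚ.< + c ℚ./ suc m
  1-ε<c/[1+m] ε@(mkℚ +[1+ p ] q′ _) _ c m le = ℚₚ.toℚᵘ-cancel-<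
    (ℚᵘₚ.<-respˡ-≃ (ℚᵘₚ.≃-sym (ℚₚ.toℚᵘ-homo-+ 1ℚ (ℚ.- ε)))
      (ℚᵘₚ.<-respʳ-≃ (ℚᵘₚ.≃-sym (ℚₚ.toℚᵘ-fromℚᵘ (ℚᵘ.mkℚᵘ (+ c) m)))
        (ℚᵘ.*<* (1-ε-cross p (suc q′) c (suc m)
                   (Q*d<c*Q+P*d {suc p} {suc q′} {c} {suc m} (s≤s z≤n) (s≤s z≤n) le)))))
  1-ε<c/[1+m] (mkℚ (+ zero) _ _) 0<ε with ℚₚ.drop-*<* 0<ε
  ... | ℤ.+<+ ()
  1-ε<c/[1+m] (mkℚ -[1+ _ ] _ _) 0<ε with ℚₚ.drop-*<* 0<ε
  ... | ()

  c/[1+m]<1+ε : ∀ ε → 0ℚ ℚ.< ε → ∀ c m → c ≤ suc m → + c ℚ./ suc m ℚ.< 1ℚ ℚ.+ ε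
  c/[1+m]<1+ε ε@(mkℚ +[1+ p ] q′ _) _ c m c≤1+m = ℚₚ.toℚᵘ-cancel-<
    (ℚᵘₚ.<-respʳ-≃ (ℚᵘₚ.≃-sym (ℚₚ.toℚᵘ-homo-+ 1ℚ ε))
      (ℚᵘₚ.<-respˡ-≃ (ℚᵘₚ.≃-sym (ℚₚ.toℚᵘ-fromℚᵘ (ℚᵘ.mkℚᵘ (+ c) m)))
        (ℚᵘ.*<* (1+ε-cross p (suc q′) c (suc m) (s≤s z≤n) c≤1+m))))
  c/[1+m]<1+ε (mkℚ (+ zero) _ _) 0<ε with ℚₚ.drop-*<* 0<ε
  ... | ℤ.+<+ ()
  c/[1+m]<1+ε (mkℚ -[1+ _ ] _ _) 0<ε with ℚₚ.drop-*<* 0<ε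
  ... | ()

open RationalBounds

module Liminf where
  open import Data.Nat.Base using (_+_)
  open import Data.Rational.Base as ℚ using (ℚ; 0ℚ; 1ℚ; ↧ₙ_)

  r>1-ε-eventually : (ε : ℚ) → 0ℚ ℚ.< ε →
    Σ ℕ (λ N → (a b c : ℕ) → 1 ≤ a → 1 ≤ b → N ≤ a → N ≤ b → IsC a b c → (1ℚ ℚ.- ε) ℚ.< r a b c)
  r>1-ε-eventually ε 0<ε = N , bound
    where
    K = 2 * ↧ₙ ε
    N = proj₁ (φ!∣φ!⇒c≥[1-1/K][a+b] K)
    bound : (a b c : ℕ) → 1 ≤ a → 1 ≤ b → N ≤ a → N ≤ b → IsC a b c → (1ℚ ℚ.- ε) ℚ.< r a b c
    bound (suc a) b c _ _ N≤a N≤b (_ , φ∣φ , _) = 1-ε<c/[1+m] ε 0<ε c (a + b)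
      (proj₂ (φ!∣φ!⇒c≥[1-1/K][a+b] K) (suc a) b c N≤a N≤b
        (subst₂ _∣_ (cong₂ _*_ (φ[n!]≡φ! (suc a)) (φ[n!]≡φ! b)) (φ[n!]≡φ! c) φ∣φ))

  r<1+ε-infinitelyOften : (ε : ℚ) → 0ℚ ℚ.< ε → (N : ℕ) →
    Σ ℕ (λ a → Σ ℕ (λ b → Σ ℕ (λ c → 1 ≤ a × 1 ≤ b × N ≤ a × N ≤ b × IsC a b c × r a b c ℚ.< 1ℚ ℚ.+ ε)))
  r<1+ε-infinitelyOften ε 0<ε N with c≤a+b-infinitelyOften N
  ... | suc a , b , c , 1≤a , 1≤b , N≤a , N≤b , isC , c≤a+b =
    suc a , b , c , 1≤a , 1≤b , N≤a , N≤b , isC , c/[1+m]<1+ε ε 0<ε c (a + b) c≤a+b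

open Liminf

open import Data.Rational using (ℚ; 0ℚ; 1ℚ; _+_; _-_) renaming (_<_ to _<ℚ_)

theorem1p3 :
    ((ε : ℚ) → 0ℚ <ℚ ε →
      Σ ℕ (λ N → (a b c : ℕ) → 1 ≤ a → 1 ≤ b → N ≤ a → N ≤ b → IsC a b c →
        (1ℚ - ε) <ℚ r a b c))
    ×
    ((ε : ℚ) → 0ℚ <ℚ ε → (N : ℕ) →
      Σ ℕ (λ a → Σ ℕ (λ b → Σ ℕ (λ c →
        1 ≤ a × 1 ≤ b × N ≤ a × N ≤ b × IsC a b c × r a b c <ℚ 1ℚ + ε))))
theorem1p3 = r>1-ε-eventually , r<1+ε-infinitelyOften
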